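{- Let $G$ be a graph and $S\subseteq V(G)$. For every $X\subseteq V(G)$ such that $|N(v)\cap C|\leq 1$ for each $v\in X\cap S$ and each $C\in\operatorname{cc}(X\setminus S)$, the graph $G[X]$ is an $S$-forest if and only if the contracted graph $G[X]_{\downarrow\operatorname{cc}(X\setminus S)}$ is a forest.
   Context: $N(v)$ is the neighborhood of $v$ in $G$, and for $U\subseteq V(G)$, $N(U)=(\bigcup_{v\in U}N(v))\setminus U$. For $Z\subseteq V(G)$, $\operatorname{cc}(Z)$ is the partition of $Z$ into the vertex sets of the connected components of $G[Z]$. An $S$-cycle is a cycle containing a vertex of $S$; an $S$-forest is a graph with no $S$-cycle. For a collection $\mathcal{A}$ of vertex subsets, the contracted graph $G[\mathcal{A}]$ has vertex set $\mathcal{A}$ (its vertices are called blocks), with $A,B\in\mathcal{A}$ adjacent iff $N(A)\cap B\neq\emptyset$. For a partition $\mathcal{P}$ of $X\setminus S$, $X_{\downarrow\mathcal{P}}=\mathcal{P}\cup\{\{v\}: v\in X\cap S\}$, and $G[X]_{\downarrow\mathcal{P}}=G[X_{\downarrow\mathcal{P}}]$. -}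

module Defs where

open import Data.Nat using (ℕ; _≤_)
open import Data.Bool using (Bool; T; false)
open import Data.Fin using (Fin)
open import Data.Fin.Subset using (Subset; _∈_; _∉_; _∩_; _─_; ⁅_⁆; ∣_∣)
open import Data.Vec using (tabulate)
open import Data.List using (List; _∷_; []; _++_; length)
open import Data.List.Relation.Unary.All using (All)
open import Data.List.Relation.Unary.Any using (Any)
open import Data.List.Relation.Unary.Linked using (Linked)
open import Data.List.Relation.Unary.Unique.Propositional using (Unique)
open import Data.Product using (Σ; ∃; ∃-syntax; _×_)
open import Data.Sum using (_⊎_)
open import Data.Unit using (⊤)
open import Relation.Nullary using (¬_)
open import Relation.Binary.PropositionalEquality using (_≡_)
open import Relation.Binary.Construct.Closure.ReflexiveTransitive using (Star)

record Graph (n : ℕ) : Set where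
  field
    adj    : Fin n → Fin n → Bool
    sym    : ∀ u v → adj u v ≡ adj v u
    irrefl : ∀ v → adj v v ≡ false

module _ {n : ℕ} (G : Graph n) where
  open Graph G

  Adj : Fin n → Fin n → Set
  Adj u v = T (adj u v)

  N : Fin n → Subset n
  N v = tabulate (adj v)

  AdjIn : Subset n → Fin n → Fin n → Set
  AdjIn Z u w = u ∈ Z × w ∈ Z × Adj u w

  ReachIn : Subset n → Fin n → Fin n → Set
  ReachIn Z = Star (AdjIn Z)

  IsComponent : Subset n → Subset n → Set
  IsComponent Z C = ∃[ v ] (v ∈ Z × (∀ u → (u ∈ C → ReachIn Z v u) × (ReachIn Z v u → u ∈ C)))

-- A cycle in a (simple) graph with vertex type V, vertex predicate InV, adjacency E:
-- distinct vertices v0, v1, ..., v_{k-1} (k ≥ 3), all in InV, consecutive ones adjacent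
-- and v_{k-1} adjacent to v0.
record CycleWith {V : Set} (InV : V → Set) (E : V → V → Set) (P : V → Set) : Set where
  field
    v0       : V
    rest     : List V
    long     : 2 ≤ length rest
    distinct : Unique (v0 ∷ rest)
    inside   : All InV (v0 ∷ rest)
    closed   : Linked E (v0 ∷ rest ++ v0 ∷ [])
    hits     : Any P (v0 ∷ rest)

IsForest : {V : Set} → (V → Set) → (V → V → Set) → Set
IsForest InV E = ¬ CycleWith InV E (λ _ → ⊤)

module _ {n : ℕ} (G : Graph n) where

  IsSForest : Subset n → Subset n → Set
  IsSForest S X = ¬ CycleWith (_∈ X) (Adj G) (_∈ S)

  -- blocks of X_{↓cc(X∖S)} = cc(X ∖ S) ∪ {{v} : v ∈ X ∩ S}
  IsBlock : Subset n → Subset n → Subset n → Set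
  IsBlock S X A = IsComponent G (X ─ S) A ⊎ (∃[ v ] (v ∈ X ∩ S × A ≡ ⁅ v ⁆))

  -- adjacency in the contracted graph: N(A) ∩ B ≠ ∅
  BlockAdj : Subset n → Subset n → Set
  BlockAdj A B = ∃[ a ] ∃[ b ] (a ∈ A × b ∈ B × b ∉ A × Adj G a b)

  ContractedForest : Subset n → Subset n → Set
  ContractedForest S X = IsForest (IsBlock S X) BlockAdj

-- Both directions are proved contrapositively.
--
-- (⇒) Lifting.  Two components of G[X ∖ S] are never adjacent, so every cycle of blocks
-- passes through an S-singleton.  Joining, inside each block, the end of the edge entering
-- it to the start of the edge leaving it gives a cycle of G[X]; it is simple because the
-- blocks are disjoint, and it passes through that S-vertex.
--
-- (⇐) Projection.  Map the closed walk around an S-cycle of G[X] to blocks and collapse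
-- runs of equal consecutive blocks.  The hypothesis forbids the image from going
-- A, B, …, B, A, so the compressed walk is non-backtracking; it is closed and not a single
-- block (the S-vertex is alone in its block), so its first repeated block closes a cycle.

module Submission where

open import Defs
open import Data.Nat using (ℕ; zero; suc; _≤_; _<_; z≤n; s≤s)
open import Data.Nat.Properties using (≤-trans; <-≤-trans; m≤n+m; ≤⇒≯)
open import Data.Bool using (Bool; true; T)
open import Data.Bool.Properties using (T-≡) renaming (_≟_ to _≟ᵇ_)
open import Data.Fin using (Fin)
open import Data.Fin.Properties using (any?) renaming (_≟_ to _≟ᶠ_)
open import Data.Fin.Subset using (Subset; _∈_; _∉_; _─_; _-_; _∩_; ⁅_⁆; ∣_∣; _⊆_)
open import Data.Fin.Subset.Properties
  using (_∈?_; x∈⁅x⁆; x∈⁅y⁆⇒x≡y; ∣⁅x⁆∣≡1; ∣p∣≤n; p⊆q⇒∣p∣≤∣q∣; ⊆-antisym; x∈p∩q⁺; x∈p∩q⁻;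
         p─q⊆p; x∈p∧x∉q⇒x∈p─q; x∈p∧x≢y⇒x∈p-y; x∈p⇒∣p-x∣<∣p∣)
open import Data.Vec using (tabulate)
open import Data.Vec.Base as Vec using ()
open import Data.Vec.Properties using (lookup∘tabulate; []=⇒lookup; lookup⇒[]=; ≡-dec)
open import Data.List using (List; []; _∷_; _++_; length; map; replicate)
open import Data.List.Properties using (∷-injective; ∷-injectiveʳ; map-++; length-++)
open import Data.List.Relation.Unary.All as All using (All; []; _∷_)
open import Data.List.Relation.Unary.All.Properties as AllP using (¬Any⇒All¬; All¬⇒¬Any)
open import Data.List.Relation.Unary.Any as Any using (Any; here; there)
open import Data.List.Relation.Unary.Any.Properties using (++⁺ʳ)
open import Data.List.Relation.Unary.Linked as Linked using (Linked; []; [-]; _∷_)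
open import Data.List.Relation.Unary.AllPairs as AllPairs using ([]; _∷_)
open import Data.List.Relation.Unary.Unique.Propositional using (Unique)
open import Data.List.Relation.Unary.Unique.Propositional.Properties as Unique using ()
open import Data.List.Membership.Propositional using () renaming (_∈_ to _∈ₗ_; _∉_ to _∉ₗ_)
open import Data.List.Membership.Propositional.Properties using (∈-∃++)
open import Data.Product using (Σ; ∃-syntax; _×_; _,_; proj₁; proj₂)
open import Data.Sum using (_⊎_; inj₁; inj₂; [_,_]′)
open import Data.Unit using (⊤; tt)
open import Data.Empty using (⊥; ⊥-elim)
open import Function using (_∘_)
open import Function.Bundles using (_⇔_; mk⇔; Equivalence)
open import Relation.Nullary using (¬_; Dec; yes; no; does)
open import Relation.Nullary.Decidable using (_×-dec_; T?; decidable-stable)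
open import Relation.Binary.Definitions using (DecidableEquality)
open import Relation.Binary.PropositionalEquality using (_≡_; _≢_; refl; sym; trans; cong; subst)
open import Relation.Binary.Construct.Closure.ReflexiveTransitive as Star using (ε; _◅_; _◅◅_)

module ListFacts {A : Set} where

  lastOr : A → List A → A
  lastOr d []       = d
  lastOr d (x ∷ xs) = lastOr x xs

  lastOr-++ : ∀ d P a Q → lastOr d (P ++ a ∷ Q) ≡ lastOr a Q
  lastOr-++ d []      a Q = refl
  lastOr-++ d (p ∷ P) a Q = lastOr-++ p P a Q

  lastOr-all : ∀ {P : A → Set} d xs → All P (d ∷ xs) → P (lastOr d xs)
  lastOr-all d []       (p ∷ [])  = p
  lastOr-all d (x ∷ xs) (_ ∷ ps) = lastOr-all x xs ps

  lastOr-∈ : ∀ d x xs → lastOr d (x ∷ xs) ∈ₗ x ∷ xs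
  lastOr-∈ d x []       = here refl
  lastOr-∈ d x (y ∷ xs) = there (lastOr-∈ x y xs)

  lastOr-self : ∀ d xs → d ∉ₗ xs → lastOr d xs ≡ d → xs ≡ []
  lastOr-self d []       _    _  = refl
  lastOr-self d (x ∷ xs) d∉xs eq = ⊥-elim (d∉xs (subst (_∈ₗ x ∷ xs) eq (lastOr-∈ d x xs)))

  unique-suffix : ∀ P {Q : List A} → Unique (P ++ Q) → Unique Q
  unique-suffix []      u       = u
  unique-suffix (p ∷ P) (_ ∷ u) = unique-suffix P u

  unique-prefix : ∀ P {Q : List A} → Unique (P ++ Q) → Unique P
  unique-prefix []      u       = []
  unique-prefix (p ∷ P) (a ∷ u) = AllP.++⁻ˡ P a ∷ unique-prefix P u

  unique-middle : ∀ ys {x : A} {zs} → Unique (ys ++ x ∷ zs) → x ∉ₗ ys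
  unique-middle (y ∷ ys) (a ∷ u) (here refl) with AllP.++⁻ʳ ys a
  ... | ne ∷ _ = ne refl
  unique-middle (y ∷ ys) (a ∷ u) (there m) = unique-middle ys u m

  module _ {R : A → A → Set} where

    linked-suffix : ∀ P {Q} → Linked R (P ++ Q) → Linked R Q
    linked-suffix []      l = l
    linked-suffix (p ∷ P) l = linked-suffix P (Linked.tail l)

    linked-join : ∀ e M {a b M'} → Linked R (e ∷ M) → lastOr e M ≡ a → R a b →
                  Linked R (b ∷ M') → Linked R (e ∷ M ++ b ∷ M')
    linked-join e []      [-]      refl r l' = r ∷ l'
    linked-join e (m ∷ M) (r₀ ∷ l) eq   r l' = r₀ ∷ linked-join m M l eq r l'

    linked-unsnoc : ∀ d xs {y} → Linked R (d ∷ xs ++ y ∷ []) → Linked R (d ∷ xs) × R (lastOr d xs) y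
    linked-unsnoc d []       (r ∷ _) = [-] , r
    linked-unsnoc d (x ∷ xs) (r ∷ l) with linked-unsnoc x xs l
    ... | l' , r' = r ∷ l' , r'

    linked-prefix : ∀ d ys {x zs} → Linked R (d ∷ ys ++ x ∷ zs) → Linked R (d ∷ ys ++ x ∷ [])
    linked-prefix d []       (r ∷ _) = r ∷ [-]
    linked-prefix d (y ∷ ys) (r ∷ l) = r ∷ linked-prefix y ys l

  ¬unique-repeat : ∀ P (y : A) M {Q : List A} → ¬ Unique (P ++ y ∷ M ++ y ∷ Q)
  ¬unique-repeat P y M u with unique-suffix P u
  ... | y∉ ∷ _ = All.lookup y∉ (++⁺ʳ M (here refl)) refl

  prefix-unique : ∀ {a : A} xs xs' {ys ys' : List A} → a ∉ₗ xs → a ∉ₗ xs' → xs ++ a ∷ ys ≡ xs' ++ a ∷ ys' → xs ≡ xs'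
  prefix-unique []       []        _    _     _  = refl
  prefix-unique []       (x' ∷ _)  _    a∉xs' eq = ⊥-elim (a∉xs' (here (proj₁ (∷-injective eq))))
  prefix-unique (x ∷ _)  []        a∉xs _     eq = ⊥-elim (a∉xs (here (sym (proj₁ (∷-injective eq)))))
  prefix-unique (x ∷ xs) (x' ∷ xs') a∉xs a∉xs' eq with ∷-injective eq
  ... | refl , eq' = cong (x ∷_) (prefix-unique xs xs' (a∉xs ∘ there) (a∉xs' ∘ there) eq')

  unique-rotate : ∀ (x : A) xs → Unique (x ∷ xs) → Unique (xs ++ x ∷ [])
  unique-rotate x xs (x∉xs ∷ un) =
    Unique.++⁺ un ([] ∷ []) λ { (x∈xs , here refl) → All.lookup x∉xs x∈xs refl }

  -- In the closed walk v₀ ∷ rest ++ [v₀] around a cycle, the only repetition is v₀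
  -- at its two ends: a segment y ∷ M ++ [y] of it has M ≡ rest.
  closed-walk-repeat : ∀ (v₀ : A) rest L₁ y M Q → Unique (v₀ ∷ rest) →
                       L₁ ++ y ∷ M ++ y ∷ Q ≡ v₀ ∷ rest ++ v₀ ∷ [] → M ≡ rest
  closed-walk-repeat v₀ rest [] y M Q un@(v₀∉rest ∷ _) eq with ∷-injective eq
  ... | refl , eq' = prefix-unique M rest (unique-middle M (subst Unique (sym eq') (unique-rotate v₀ rest un)))
                                          (All¬⇒¬Any v₀∉rest) eq'
  closed-walk-repeat v₀ rest (p ∷ L₁) y M Q un eq =
    ⊥-elim (¬unique-repeat L₁ y M (subst Unique (sym (∷-injectiveʳ eq)) (unique-rotate v₀ rest un)))

  all-any : ∀ {P Q : A → Set} {xs} → All P xs → Any Q xs → ∃[ x ] (P x × Q x)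
  all-any (p ∷ _)  (here q)  = _ , p , q
  all-any (_ ∷ ps) (there a) = all-any ps a

  NonBacktracking : List A → Set
  NonBacktracking (x ∷ y ∷ z ∷ t) = x ≢ z × NonBacktracking (y ∷ z ∷ t)
  NonBacktracking _               = ⊤

  nonBacktracking-tail : ∀ x xs → NonBacktracking (x ∷ xs) → NonBacktracking xs
  nonBacktracking-tail x []          _       = tt
  nonBacktracking-tail x (y ∷ [])    _       = tt
  nonBacktracking-tail x (y ∷ z ∷ t) (_ , b) = b

  nonBacktracking-cons : ∀ x y D → (∀ z T → D ≡ z ∷ T → x ≢ z) →
                         NonBacktracking (y ∷ D) → NonBacktracking (x ∷ y ∷ D)
  nonBacktracking-cons x y []      _ b = tt
  nonBacktracking-cons x y (z ∷ T) f b = f z T refl , b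

open ListFacts

-- The first repeated vertex of a non-backtracking walk closes a cycle (of length ≥ 3,
-- since R is irreflexive and the walk does not backtrack).
module _ {A : Set} (_≟_ : DecidableEquality A) {R : A → A → Set} (R-irrefl : ∀ {a} → ¬ R a a) where
  open import Data.List.Membership.DecPropositional _≟_ using () renaming (_∈?_ to _∈ₗ?_)

  unique-or-cycle : ∀ {P : A → Set} D → Linked R D → NonBacktracking D → All P D →
                    Unique D ⊎ CycleWith P R (λ _ → ⊤)
  unique-or-cycle [] _ _ _ = inj₁ []
  unique-or-cycle (x ∷ D) l nb (px ∷ pD)
    with unique-or-cycle D (Linked.tail l) (nonBacktracking-tail x D nb) pD
  ... | inj₂ c = inj₂ c
  ... | inj₁ u with x ∈ₗ? D
  ...   | no x∉D = inj₁ (¬Any⇒All¬ _ x∉D ∷ u)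
  ...   | yes x∈D with ∈-∃++ x∈D
  ...     | ys , zs , refl = inj₂ record
            { v0       = x
            ; rest     = ys
            ; long     = long ys l nb
            ; distinct = ¬Any⇒All¬ _ (unique-middle ys u) ∷ unique-prefix ys u
            ; inside   = AllP.++⁻ˡ (x ∷ ys) (px ∷ pD)
            ; closed   = linked-prefix x ys l
            ; hits     = here tt }
    where
    long : ∀ ys {zs} → Linked R (x ∷ ys ++ x ∷ zs) → NonBacktracking (x ∷ ys ++ x ∷ zs) → 2 ≤ length ys
    long []           (r ∷ _) _       = ⊥-elim (R-irrefl r)
    long (y ∷ [])     _       (x≢x , _) = ⊥-elim (x≢x refl)
    long (y ∷ y' ∷ _) _       _       = s≤s (s≤s z≤n)

module _ {A B : Set} (f : A → B) where

  map-split : ∀ P {Q} L → map f L ≡ P ++ Q → ∃[ L₁ ] ∃[ L₂ ] (L ≡ L₁ ++ L₂ × map f L₁ ≡ P × map f L₂ ≡ Q)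
  map-split []      L       eq = [] , L , refl , refl , eq
  map-split (p ∷ P) (x ∷ L) eq with ∷-injective eq
  ... | refl , eq' with map-split P L eq'
  ... | L₁ , L₂ , refl , refl , eq₂ = x ∷ L₁ , L₂ , refl , refl , eq₂

  map-cons : ∀ {b Q} L → map f L ≡ b ∷ Q → ∃[ x ] ∃[ L' ] (L ≡ x ∷ L' × f x ≡ b × map f L' ≡ Q)
  map-cons (x ∷ L) eq with ∷-injective eq
  ... | fx≡b , eq' = x , L , refl , fx≡b , eq'

module Compression {A : Set} (_≟_ : DecidableEquality A) where

  compressFrom : A → List A → List A
  compressFrom x []       = x ∷ []
  compressFrom x (y ∷ ys) with x ≟ y
  ... | yes _ = compressFrom y ys
  ... | no _  = x ∷ compressFrom y ys

  compress : List A → List A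
  compress []       = []
  compress (x ∷ xs) = compressFrom x xs

  NoBounce : List A → Set
  NoBounce E = ∀ P a b Z Q → E ≡ P ++ a ∷ b ∷ Z ++ a ∷ Q → All (_≡ b) Z → a ≢ b → ⊥

  compressFrom-head : ∀ x E → ∃[ T ] (compressFrom x E ≡ x ∷ T)
  compressFrom-head x []       = [] , refl
  compressFrom-head x (y ∷ ys) with x ≟ y
  ... | yes refl = compressFrom-head y ys
  ... | no _     = compressFrom y ys , refl

  compressFrom-run : ∀ x E → Σ ℕ λ r → ∃[ zs ] (E ≡ replicate r x ++ zs × compressFrom x E ≡ x ∷ compress zs)
  compressFrom-run x []       = 0 , [] , refl , refl
  compressFrom-run x (e ∷ E) with x ≟ e
  ... | no _     = 0 , e ∷ E , refl , refl
  ... | yes refl with compressFrom-run x E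
  ...   | r , zs , E≡ , c≡ = suc r , zs , cong (x ∷_) E≡ , c≡

  compressFrom-all : ∀ {P : A → Set} x E → All P (x ∷ E) → All P (compressFrom x E)
  compressFrom-all x []       (p ∷ [])  = p ∷ []
  compressFrom-all x (y ∷ ys) (p ∷ ps) with x ≟ y
  ... | yes _ = compressFrom-all y ys ps
  ... | no _  = p ∷ compressFrom-all y ys ps

  compressFrom-linked : ∀ {R' R : A → A → Set} → (∀ {a b} → R' a b → a ≢ b → R a b) →
                        ∀ x E → Linked R' (x ∷ E) → Linked R (compressFrom x E)
  compressFrom-linked h x []       _       = [-]
  compressFrom-linked h x (y ∷ ys) (r ∷ l) with x ≟ y
  ... | yes _  = compressFrom-linked h y ys l
  ... | no x≢y with compressFrom-head y ys | compressFrom-linked h y ys l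
  ...   | T , c≡ | l' rewrite c≡ = h r x≢y ∷ l'

  private
    all-replicate : ∀ r (y : A) → All (_≡ y) (replicate r y)
    all-replicate zero    y = []
    all-replicate (suc r) y = refl ∷ all-replicate r y

    noBounce-tail : ∀ x E → NoBounce (x ∷ E) → NoBounce E
    noBounce-tail x E nb P a b Z Q E≡ = nb (x ∷ P) a b Z Q (cong (x ∷_) E≡)

    no-return : ∀ x y r zs ys → NoBounce (x ∷ y ∷ ys) → x ≢ y → ys ≡ replicate r y ++ zs →
                ∀ z T → compress zs ≡ z ∷ T → x ≢ z
    no-return x y r []         ys nb x≢y ys≡ z T ()
    no-return x y r (z' ∷ zs') ys nb x≢y ys≡ z T c≡ x≡z with compressFrom-head z' zs'
    ... | T' , c'≡ with trans (sym c'≡) c≡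
    ... | refl = nb [] x y (replicate r y) zs'
                    (cong (λ t → x ∷ y ∷ t) (trans ys≡ (cong (λ w → replicate r y ++ w ∷ zs') (sym x≡z))))
                    (all-replicate r y) x≢y

  compressFrom-nonBacktracking : ∀ x E → NoBounce (x ∷ E) → NonBacktracking (compressFrom x E)
  compressFrom-nonBacktracking x []       _  = tt
  compressFrom-nonBacktracking x (y ∷ ys) nb with x ≟ y
  ... | yes refl = compressFrom-nonBacktracking y ys (noBounce-tail x (y ∷ ys) nb)
  ... | no x≢y with compressFrom-run y ys | compressFrom-nonBacktracking y ys (noBounce-tail x (y ∷ ys) nb)
  ...   | r , zs , ys≡ , c≡ | ih rewrite c≡ =
          nonBacktracking-cons x y (compress zs) (no-return x y r zs ys nb x≢y ys≡) ih

  compressFrom-constant : ∀ x E → All (_≡ x) E → compressFrom x E ≡ x ∷ []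
  compressFrom-constant x []      []          = refl
  compressFrom-constant x (y ∷ E) (refl ∷ E≡x) with x ≟ y
  ... | yes _  = compressFrom-constant x E E≡x
  ... | no x≢x = ⊥-elim (x≢x refl)

  compressFrom-ends : ∀ x E w → (∃[ D ] (compressFrom x (E ++ w ∷ []) ≡ x ∷ D ++ w ∷ []))
                                ⊎ (x ≡ w × All (_≡ x) E)
  compressFrom-ends x []      w with x ≟ w
  ... | yes refl = inj₂ (refl , [])
  ... | no _     = inj₁ ([] , refl)
  compressFrom-ends x (y ∷ E) w with x ≟ y
  ... | yes refl with compressFrom-ends x E w
  ...   | inj₁ ends        = inj₁ ends
  ...   | inj₂ (x≡w , E≡x) = inj₂ (x≡w , refl ∷ E≡x)
  compressFrom-ends x (y ∷ E) w | no _ with compressFrom-ends y E w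
  ...   | inj₁ (D , c≡)   = inj₁ (y ∷ D , cong (x ∷_) c≡)
  ...   | inj₂ (refl , E≡y) = inj₁ ([] , cong (x ∷_) (compressFrom-constant y (E ++ y ∷ []) (AllP.++⁺ E≡y (refl ∷ []))))

x∈p─q⇒x∉q : ∀ {m} (p q : Subset m) {x} → x ∈ p ─ q → x ∉ q
x∈p─q⇒x∉q (_ Vec.∷ p) (_ Vec.∷ q) (Vec.there x∈) (Vec.there x∈q) = x∈p─q⇒x∉q p q x∈ x∈q

two-elements : ∀ {m} {x y : Fin m} {p : Subset m} → x ≢ y → x ∈ p → y ∈ p → 2 ≤ ∣ p ∣
two-elements {x = x} {y} {p} x≢y x∈ y∈ = ≤-trans (s≤s one≤∣p-x∣) (x∈p⇒∣p-x∣<∣p∣ x∈)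
  where
  one≤∣p-x∣ : 1 ≤ ∣ p - x ∣
  one≤∣p-x∣ = subst (_≤ ∣ p - x ∣) (∣⁅x⁆∣≡1 y)
                (p⊆q⇒∣p∣≤∣q∣ λ w∈ → subst (_∈ p - x) (sym (x∈⁅y⁆⇒x≡y y w∈)) (x∈p∧x≢y⇒x∈p-y y∈ (x≢y ∘ sym)))

∈-tabulate⁺ : ∀ {m} (g : Fin m → Bool) u → g u ≡ true → u ∈ tabulate g
∈-tabulate⁺ g u gu = lookup⇒[]= u (tabulate g) (trans (lookup∘tabulate g u) gu)

∈-tabulate⁻ : ∀ {m} (g : Fin m → Bool) u → u ∈ tabulate g → g u ≡ true
∈-tabulate⁻ g u u∈ = trans (sym (lookup∘tabulate g u)) ([]=⇒lookup u∈)

module GraphFacts {n : ℕ} (G : Graph n) where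
  open import Data.List.Membership.DecPropositional (_≟ᶠ_ {n}) using () renaming (_∈?_ to _∈ₗ?_)

  adj-sym : ∀ {u v} → Adj G u v → Adj G v u
  adj-sym {u} {v} = subst T (Graph.sym G u v)

  adj-irrefl : ∀ {v} → ¬ Adj G v v
  adj-irrefl {v} = subst T (Graph.irrefl G v)

  ∈-N : ∀ {v x} → Adj G v x → x ∈ N G v
  ∈-N {v} {x} a = ∈-tabulate⁺ (Graph.adj G v) x (Equivalence.to T-≡ a)

  reach-sym : ∀ {W u v} → ReachIn G W u v → ReachIn G W v u
  reach-sym = Star.reverse (λ { (u∈ , v∈ , a) → v∈ , u∈ , adj-sym a })

  reach-inside : ∀ {W v u} → v ∈ W → ReachIn G W v u → u ∈ W
  reach-inside v∈ ε                  = v∈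
  reach-inside _  ((_ , w∈ , _) ◅ p) = reach-inside w∈ p

  private
    reach-weaken : ∀ {W v x u} → ReachIn G (W - v) x u → ReachIn G W x u
    reach-weaken = Star.map (λ { (a∈ , b∈ , e) → p─q⊆p _ _ a∈ , p─q⊆p _ _ b∈ , e })

    start-inside : ∀ {W y u} → ReachIn G W y u → y ≡ u ⊎ y ∈ W
    start-inside ε             = inj₁ refl
    start-inside ((y∈ , _) ◅ _) = inj₂ y∈

  last-visit : ∀ {W v x u} → u ≢ v → ReachIn G W x u →
               ReachIn G (W - v) x u ⊎ ∃[ w ] (AdjIn G W v w × ReachIn G (W - v) w u)
  last-visit u≢v ε = inj₁ ε
  last-visit {W} {v} {x} u≢v (step@(x∈ , y∈ , a) ◅ p) with last-visit u≢v p
  ... | inj₂ r = inj₂ r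
  ... | inj₁ q with x ≟ᶠ v
  ...   | yes refl = inj₂ (_ , step , q)
  ...   | no x≢v   = inj₁ ((x∈p∧x≢y⇒x∈p-y x∈ x≢v , y∈' , a) ◅ q)
    where
    y∈' = [ (λ { refl → x∈p∧x≢y⇒x∈p-y y∈ u≢v }) , (λ y∈ → y∈) ]′ (start-inside q)

  -- Reachability in G[W] is decidable, by recursion on ∣ W ∣: from v ≢ u, by last-visit,
  -- u is reachable iff it is reachable in G[W - v] from some neighbour w of v.
  reachable? : ∀ W v u → Dec (ReachIn G W v u)
  reachable? W = bounded (suc n) W (s≤s (∣p∣≤n W))
    where
    adjIn? : ∀ W v w → Dec (AdjIn G W v w)
    adjIn? W v w = (v ∈? W) ×-dec ((w ∈? W) ×-dec T? (Graph.adj G v w))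

    bounded : (k : ℕ) (W : Subset n) → ∣ W ∣ < k → ∀ v u → Dec (ReachIn G W v u)
    bounded (suc k) W (s≤s ∣W∣≤k) v u with v ≟ᶠ u
    ... | yes refl = yes ε
    ... | no v≢u with v ∈? W
    ...   | no v∉W = no λ { ε → v≢u refl ; ((v∈ , _) ◅ _) → v∉W v∈ }
    ...   | yes v∈W with any? (λ w → adjIn? W v w ×-dec
                                  bounded k (W - v) (<-≤-trans (x∈p⇒∣p-x∣<∣p∣ v∈W) ∣W∣≤k) w u)
    ...     | yes (w , a , r) = yes (a ◅ reach-weaken r)
    ...     | no ¬step = no λ p → [ avoids , ¬step ]′ (last-visit (λ u≡v → v≢u (sym u≡v)) p)
      where
      avoids : ¬ ReachIn G (W - v) v u
      avoids ε               = v≢u refl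
      avoids ((v∈ , _) ◅ _) = x∈p─q⇒x∉q W ⁅ v ⁆ v∈ (x∈⁅x⁆ v)

  component : Subset n → Fin n → Subset n
  component W v = tabulate (λ u → does (reachable? W v u))

  ∈-component⁺ : ∀ {W v u} → ReachIn G W v u → u ∈ component W v
  ∈-component⁺ {W} {v} {u} r with reachable? W v u in eq
  ... | yes _ = ∈-tabulate⁺ _ u (cong does eq)
  ... | no ¬r = ⊥-elim (¬r r)

  ∈-component⁻ : ∀ {W v u} → u ∈ component W v → ReachIn G W v u
  ∈-component⁻ {W} {v} {u} u∈ with reachable? W v u | ∈-tabulate⁻ _ u u∈
  ... | yes r | _ = r

  component-isComponent : ∀ {W v} → v ∈ W → IsComponent G W (component W v)
  component-isComponent {v = v} v∈ = v , v∈ , λ u → ∈-component⁻ , ∈-component⁺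

  isComponent-⊆ : ∀ {W C u} → IsComponent G W C → u ∈ C → u ∈ W
  isComponent-⊆ (v , v∈ , spans) u∈ = reach-inside v∈ (proj₁ (spans _) u∈)

  isComponent-connected : ∀ {W C u w} → IsComponent G W C → u ∈ C → w ∈ C → ReachIn G W u w
  isComponent-connected (v , _ , spans) u∈ w∈ = reach-sym (proj₁ (spans _) u∈) ◅◅ proj₁ (spans _) w∈

  isComponent-unique : ∀ {W C C' w} → IsComponent G W C → IsComponent G W C' → w ∈ C → w ∈ C' → C ≡ C'
  isComponent-unique {W} {C} {C'} {w} isC@(_ , _ , spans) isC'@(_ , _ , spans') w∈C w∈C' =
    ⊆-antisym (grow isC isC' w∈C w∈C') (grow isC' isC w∈C' w∈C)
    where
    grow : ∀ {C C'} → IsComponent G W C → IsComponent G W C' → w ∈ C → w ∈ C' → C ⊆ C'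
    grow isC (_ , _ , spans') w∈C w∈C' u∈C =
      proj₂ (spans' _) (proj₁ (spans' _) w∈C' ◅◅ isComponent-connected isC w∈C u∈C)

  record Path (P : Fin n → Set) (a b : Fin n) : Set where
    constructor mkPath
    field
      verts    : List (Fin n)
      linked   : Linked (Adj G) (a ∷ verts)
      distinct : Unique (a ∷ verts)
      inside   : All P (a ∷ verts)
      ends     : lastOr a verts ≡ b

  -- Every walk contains a path between its endpoints (cut out the closed sub-walks).
  walk⇒path : ∀ {W a b} → ReachIn G W a b → Path (ReachIn G W a) a b
  walk⇒path ε = mkPath [] [-] ([] ∷ []) (ε ∷ []) refl
  walk⇒path {W} {a} (step@(_ , _ , e) ◅ p) with walk⇒path p
  ... | mkPath M lk un reach ends with a ∈ₗ? (_ ∷ M)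
  ...   | no a∉ = mkPath (_ ∷ M) (e ∷ lk) (¬Any⇒All¬ _ a∉ ∷ un) (ε ∷ All.map (step ◅_) reach) ends
  ...   | yes a∈ with ∈-∃++ a∈
  ...     | P , Q , M≡ = mkPath Q
                           (linked-suffix P (subst (Linked (Adj G)) M≡ lk))
                           (unique-suffix P (subst Unique M≡ un))
                           (All.map (step ◅_) (AllP.++⁻ʳ P (subst (All _) M≡ reach)))
                           (trans (sym (lastOr-++ a P a Q)) (trans (cong (lastOr a) (sym M≡)) ends))

  path-map : ∀ {P Q : Fin n → Set} {a b} → (∀ {w} → P w → Q w) → Path P a b → Path Q a b
  path-map f (mkPath M lk un inP ends) = mkPath M lk un (All.map f inP) ends

  path-join : ∀ {P Q : Fin n → Set} {a c d e} → (∀ {w} → P w → ¬ Q w) →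
              Path P a c → Adj G c d → Path Q d e → Path (λ w → P w ⊎ Q w) a e
  path-join {a = a} {d = d} disj (mkPath M₁ lk₁ un₁ in₁ ends₁) cd (mkPath M₂ lk₂ un₂ in₂ ends₂) =
    mkPath (M₁ ++ d ∷ M₂)
           (linked-join a M₁ lk₁ ends₁ cd lk₂)
           (Unique.++⁺ un₁ un₂ λ (w∈₁ , w∈₂) → disj (All.lookup in₁ w∈₁) (All.lookup in₂ w∈₂))
           (AllP.++⁺ (All.map inj₁ in₁) (All.map inj₂ in₂))
           (trans (lastOr-++ a M₁ d M₂) ends₂)

blockAdj-irrefl : ∀ {n} {G : Graph n} {A} → ¬ BlockAdj G A A
blockAdj-irrefl (_ , _ , _ , b∈A , b∉A , _) = b∉A b∈A

module Blocks {n : ℕ} (G : Graph n) (S X : Subset n) where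
  open GraphFacts G

  IsBlk : Subset n → Set
  IsBlk = IsBlock G S X

  ∈-singleton : ∀ {v w} → v ∈ X ∩ S → w ∈ ⁅ v ⁆ → w ∈ X × w ∈ S
  ∈-singleton {v} v∈ w∈ with x∈⁅y⁆⇒x≡y v w∈
  ... | refl = x∈p∩q⁻ X S v∈

  ∈-X∖S : ∀ {u} → u ∈ X ─ S → u ∈ X × u ∉ S
  ∈-X∖S u∈ = p─q⊆p X S u∈ , x∈p─q⇒x∉q X S u∈

  block-⊆X : ∀ {A w} → IsBlk A → w ∈ A → w ∈ X
  block-⊆X (inj₁ isC)            w∈ = proj₁ (∈-X∖S (isComponent-⊆ isC w∈))
  block-⊆X (inj₂ (v , v∈ , refl)) w∈ = proj₁ (∈-singleton v∈ w∈)

  blocks-disjoint : ∀ {A A' w} → IsBlk A → IsBlk A' → w ∈ A → w ∈ A' → A ≡ A'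
  blocks-disjoint (inj₁ isC) (inj₁ isC') w∈ w∈' = isComponent-unique isC isC' w∈ w∈'
  blocks-disjoint (inj₁ isC) (inj₂ (v , v∈ , refl)) w∈ w∈' =
    ⊥-elim (proj₂ (∈-X∖S (isComponent-⊆ isC w∈)) (proj₂ (∈-singleton v∈ w∈')))
  blocks-disjoint (inj₂ (v , v∈ , refl)) (inj₁ isC) w∈ w∈' =
    ⊥-elim (proj₂ (∈-X∖S (isComponent-⊆ isC w∈')) (proj₂ (∈-singleton v∈ w∈)))
  blocks-disjoint (inj₂ (v , _ , refl)) (inj₂ (v' , _ , refl)) w∈ w∈'
    with x∈⁅y⁆⇒x≡y v w∈ | x∈⁅y⁆⇒x≡y v' w∈'
  ... | refl | refl = refl

  InS : Subset n → Set
  InS A = ∀ {w} → w ∈ A → w ∈ S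

  -- Distinct components of G[X ∖ S] are not adjacent, so every edge of the
  -- contracted graph has an endpoint inside S.
  blockAdj-InS : ∀ {A A'} → IsBlk A → IsBlk A' → BlockAdj G A A' → InS A ⊎ InS A'
  blockAdj-InS (inj₂ (v , v∈ , refl)) _ _ = inj₁ λ w∈ → proj₂ (∈-singleton v∈ w∈)
  blockAdj-InS (inj₁ _) (inj₂ (v , v∈ , refl)) _ = inj₂ λ w∈ → proj₂ (∈-singleton v∈ w∈)
  blockAdj-InS (inj₁ isC@(_ , _ , spans)) (inj₁ isC') (a , b , a∈ , b∈ , b∉ , e) =
    ⊥-elim (b∉ (proj₂ (spans b) (proj₁ (spans a) a∈ ◅◅ (isComponent-⊆ isC a∈ , isComponent-⊆ isC' b∈ , e) ◅ ε)))

  block-path : ∀ {A e x} → IsBlk A → e ∈ A → x ∈ A → Path (_∈ A) e x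
  block-path (inj₂ (v , _ , refl)) e∈ x∈ with x∈⁅y⁆⇒x≡y v e∈ | x∈⁅y⁆⇒x≡y v x∈
  ... | refl | refl = mkPath [] [-] ([] ∷ []) (e∈ ∷ []) refl
  block-path (inj₁ isC@(_ , _ , spans)) e∈ x∈ with walk⇒path (isComponent-connected isC e∈ x∈)
  ... | mkPath M lk un reach ends =
        mkPath M lk un (All.map (λ r → proj₂ (spans _) (proj₁ (spans _) e∈ ◅◅ r)) reach) ends

module Lifting {n : ℕ} (G : Graph n) (S X : Subset n) where
  open GraphFacts G
  open Blocks G S X

  InSome : List (Subset n) → Fin n → Set
  InSome Bs w = Any (w ∈_) Bs

  block-occurs : ∀ {B w} Cs → IsBlk B → w ∈ B → All IsBlk Cs → InSome Cs w → B ∈ₗ Cs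
  block-occurs (C ∷ Cs) isB w∈B (isC ∷ _)  (here w∈C) = here (blocks-disjoint isB isC w∈B w∈C)
  block-occurs (C ∷ Cs) isB w∈B (_ ∷ isCs) (there w∈) = there (block-occurs Cs isB w∈B isCs w∈)

  record Lift (B : Subset n) (Bs : List (Subset n)) (e x : Fin n) : Set where
    constructor mkLift
    field
      path   : Path (InSome (B ∷ Bs)) e x
      long   : length Bs ≤ length (Path.verts path)
      visits : All (λ C → Any (_∈ C) (e ∷ Path.verts path)) (B ∷ Bs)

  lift-walk : ∀ B Bs → Linked (BlockAdj G) (B ∷ Bs) → All IsBlk (B ∷ Bs) → Unique (B ∷ Bs) →
              ∀ {e x} → e ∈ B → x ∈ lastOr B Bs → Lift B Bs e x
  lift-walk B [] _ (isB ∷ []) _ e∈B x∈B =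
    mkLift (path-map here (block-path isB e∈B x∈B)) z≤n (here e∈B ∷ [])
  lift-walk B (B' ∷ Bs) ((a , b , a∈B , b∈B' , _ , ab) ∷ lk) (isB ∷ isBs) (B∉ ∷ un) {e} e∈B x∈
    with lift-walk B' Bs lk isBs un b∈B' x∈
  ... | mkLift path₂ long₂ visits₂ =
        mkLift (path-map [ here , there ]′ (path-join disjoint (block-path isB e∈B a∈B) ab path₂))
               (longer (Path.verts path₁) long₂)
               (here e∈B ∷ All.map (++⁺ʳ (e ∷ Path.verts path₁)) visits₂)
    where
    path₁ = block-path isB e∈B a∈B

    disjoint : ∀ {w} → w ∈ B → ¬ InSome (B' ∷ Bs) w
    disjoint w∈B w∈ = All.lookup B∉ (block-occurs (B' ∷ Bs) isB w∈B isBs w∈) refl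

    longer : ∀ M₁ {M₂} → length Bs ≤ length M₂ → suc (length Bs) ≤ length (M₁ ++ b ∷ M₂)
    longer M₁ {M₂} ≤M₂ rewrite length-++ M₁ {b ∷ M₂} = ≤-trans (s≤s ≤M₂) (m≤n+m _ (length M₁))

  some-block-InS : ∀ B Bs → 2 ≤ length Bs → Linked (BlockAdj G) (B ∷ Bs) → All IsBlk (B ∷ Bs) →
                   Any InS (B ∷ Bs)
  some-block-InS B (B₁ ∷ _) _ (adj ∷ _) (isB ∷ isB₁ ∷ _) with blockAdj-InS isB isB₁ adj
  ... | inj₁ B⊆S  = here B⊆S
  ... | inj₂ B₁⊆S = there (here B₁⊆S)

  lift-cycle : CycleWith IsBlk (BlockAdj G) (λ _ → ⊤) → CycleWith (_∈ X) (Adj G) (_∈ S)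
  lift-cycle c = close (linked-unsnoc v0 rest closed)
    where
    open CycleWith c

    inX : ∀ {w} → InSome (v0 ∷ rest) w → w ∈ X
    inX w∈ with all-any inside w∈
    ... | _ , isC , w∈C = block-⊆X isC w∈C

    -- The closing edge runs from a in the last block to b in the first one.
    close : Linked (BlockAdj G) (v0 ∷ rest) × BlockAdj G (lastOr v0 rest) v0 →
            CycleWith (_∈ X) (Adj G) (_∈ S)
    close (lk , (a , b , a∈ , b∈ , _ , ab)) with lift-walk v0 rest lk inside distinct b∈ a∈
    ... | mkLift (mkPath M lkM unM inM ends) longM visits = record
          { v0       = b
          ; rest     = M
          ; long     = ≤-trans long longM
          ; distinct = unM
          ; inside   = All.map inX inM
          ; closed   = linked-join b M lkM ends ab [-]
          ; hits     = hitsS }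
      where
      hitsS : Any (_∈ S) (b ∷ M)
      hitsS with all-any visits (some-block-InS v0 rest long lk inside)
      ... | _ , visited , C⊆S = Any.map C⊆S visited

-- The hypothesis on S-vertices is what rules out backtracking.
module Projection {n : ℕ} (G : Graph n) (S X : Subset n)
  (hyp : ∀ v C → v ∈ X ∩ S → IsComponent G (X ─ S) C → ∣ N G v ∩ C ∣ ≤ 1) where
  open GraphFacts G
  open Blocks G S X

  one-neighbour : ∀ {v C x x'} → v ∈ X ∩ S → IsComponent G (X ─ S) C →
                  x ∈ C → x' ∈ C → Adj G v x → Adj G v x' → x ≡ x'
  one-neighbour {v} {C} v∈ isC x∈ x'∈ vx vx' = decidable-stable (_ ≟ᶠ _) λ x≢x' →
    ≤⇒≯ (hyp v C v∈ isC) (two-elements x≢x' (x∈p∩q⁺ (∈-N vx , x∈)) (x∈p∩q⁺ (∈-N vx' , x'∈)))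

  blockOf : Fin n → Subset n
  blockOf v with v ∈? S
  ... | yes _ = ⁅ v ⁆
  ... | no _  = component (X ─ S) v

  blockOf-cases : ∀ v → (v ∈ S × blockOf v ≡ ⁅ v ⁆) ⊎ (v ∉ S × blockOf v ≡ component (X ─ S) v)
  blockOf-cases v with v ∈? S
  ... | yes v∈S = inj₁ (v∈S , refl)
  ... | no v∉S  = inj₂ (v∉S , refl)

  ∈-blockOf : ∀ v → v ∈ blockOf v
  ∈-blockOf v with blockOf-cases v
  ... | inj₁ (_ , eq) = subst (v ∈_) (sym eq) (x∈⁅x⁆ v)
  ... | inj₂ (_ , eq) = subst (v ∈_) (sym eq) (∈-component⁺ ε)

  blockOf-isBlock : ∀ {v} → v ∈ X → IsBlk (blockOf v)
  blockOf-isBlock {v} v∈X with blockOf-cases v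
  ... | inj₁ (v∈S , eq) = inj₂ (v , x∈p∩q⁺ (v∈X , v∈S) , eq)
  ... | inj₂ (v∉S , eq) = inj₁ (subst (IsComponent G (X ─ S)) (sym eq)
                                  (component-isComponent (x∈p∧x∉q⇒x∈p─q v∈X v∉S)))

  blockOf-≡ : ∀ {u v} → u ∈ X → v ∈ X → u ∈ blockOf v → blockOf u ≡ blockOf v
  blockOf-≡ {u} u∈X v∈X u∈ = blocks-disjoint (blockOf-isBlock u∈X) (blockOf-isBlock v∈X) (∈-blockOf u) u∈

  blockOf-edge : ∀ {u v} → u ∈ X → v ∈ X → u ∉ S → v ∉ S → Adj G u v → blockOf u ≡ blockOf v
  blockOf-edge {u} {v} u∈X v∈X u∉S v∉S uv with blockOf-cases u
  ... | inj₁ (u∈S , _) = ⊥-elim (u∉S u∈S)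
  ... | inj₂ (_ , eq)  = sym (blockOf-≡ v∈X u∈X (subst (v ∈_) (sym eq)
                           (∈-component⁺ ((x∈p∧x∉q⇒x∈p─q u∈X u∉S , x∈p∧x∉q⇒x∈p─q v∈X v∉S , uv) ◅ ε))))

  blockOf-edge-S : ∀ {u v} → u ∈ X → v ∈ X → Adj G u v → blockOf u ≢ blockOf v → u ∈ S ⊎ v ∈ S
  blockOf-edge-S {u} {v} u∈X v∈X uv ≢ with blockOf-cases u | blockOf-cases v
  ... | inj₁ (u∈S , _) | _              = inj₁ u∈S
  ... | inj₂ _         | inj₁ (v∈S , _) = inj₂ v∈S
  ... | inj₂ (u∉S , _) | inj₂ (v∉S , _) = ⊥-elim (≢ (blockOf-edge u∈X v∈X u∉S v∉S uv))

  blockOf-S : ∀ {u w} → u ∈ S → blockOf w ≡ blockOf u → w ≡ u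
  blockOf-S {u} {w} u∈S eq with blockOf-cases u
  ... | inj₁ (_ , eq')  = x∈⁅y⁆⇒x≡y u (subst (w ∈_) (trans eq eq') (∈-blockOf w))
  ... | inj₂ (u∉S , _) = ⊥-elim (u∉S u∈S)

  blockOf-component : ∀ {u w} → u ∉ S → blockOf w ≡ blockOf u → w ∈ component (X ─ S) u
  blockOf-component {u} {w} u∉S eq with blockOf-cases u
  ... | inj₁ (u∈S , _) = ⊥-elim (u∉S u∈S)
  ... | inj₂ (_ , eq') = subst (w ∈_) (trans eq eq') (∈-blockOf w)

  _≟ˢ_ : (A B : Subset n) → Dec (A ≡ B)
  _≟ˢ_ = ≡-dec _≟ᵇ_

  -- The image of a walk of G[X] is a walk of the contracted graph that may pause.
  StepOrStay : Subset n → Subset n → Set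
  StepOrStay A B = A ≡ B ⊎ BlockAdj G A B

  image-linked : ∀ L → Linked (Adj G) L → All (_∈ X) L → Linked StepOrStay (map blockOf L)
  image-linked []          _        _                = []
  image-linked (u ∷ [])    _        _                = [-]
  image-linked (u ∷ w ∷ L) (uw ∷ l) (u∈X ∷ w∈X ∷ inX) = step ∷ image-linked (w ∷ L) l (w∈X ∷ inX)
    where
    step : StepOrStay (blockOf u) (blockOf w)
    step with blockOf u ≟ˢ blockOf w
    ... | yes eq = inj₁ eq
    ... | no ≢   = inj₂ (u , w , ∈-blockOf u , ∈-blockOf w , (λ w∈ → ≢ (sym (blockOf-≡ w∈X u∈X w∈))) , uw)

  run-at-S : ∀ z Z {T} → z ∈ S → All (λ w → blockOf w ≡ blockOf z) Z → Linked (Adj G) (z ∷ Z ++ T) → Z ≡ []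
  run-at-S z []      _   _        _        = refl
  run-at-S z (_ ∷ _) z∈S (eq ∷ _) (zz₂ ∷ _) = ⊥-elim (adj-irrefl (subst (Adj G z) (blockOf-S z∈S eq) zz₂))

  -- The vertices of an S-cycle do not all lie in one block: the S-vertex is alone in its
  -- block, and the cycle has two distinct vertices.
  not-one-block : ∀ v0 rest → 2 ≤ length rest → Unique (v0 ∷ rest) → Any (_∈ S) (v0 ∷ rest) →
                  ¬ All (λ w → blockOf w ≡ blockOf v0) rest
  not-one-block v0 (r₁ ∷ _) _ ((v0≢r₁ ∷ _) ∷ _) hits (r₁≈ ∷ same) with all-any (refl ∷ r₁≈ ∷ same) hits
  ... | s , s≈ , s∈S = v0≢r₁ (trans (blockOf-S s∈S (sym s≈)) (sym (blockOf-S s∈S (trans r₁≈ (sym s≈)))))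

  open Compression _≟ˢ_

  module OnCycle (c : CycleWith (_∈ X) (Adj G) (_∈ S)) where
    open CycleWith c

    walk : List (Fin n)
    walk = v0 ∷ rest ++ v0 ∷ []

    walk-inX : All (_∈ X) walk
    walk-inX = AllP.++⁺ inside (All.head inside ∷ [])

    no-bounce-segment : ∀ L₁ y z Z y' Q → walk ≡ L₁ ++ y ∷ z ∷ Z ++ y' ∷ Q →
                        blockOf y ≡ blockOf y' → All (λ w → blockOf w ≡ blockOf z) Z →
                        blockOf y ≢ blockOf z → ⊥
    no-bounce-segment L₁ y z Z y' Q eq yy' run y≁z = Z≢[] Z≡[]
      where
      segment-linked : Linked (Adj G) (y ∷ z ∷ Z ++ y' ∷ Q)
      segment-linked = linked-suffix L₁ (subst (Linked (Adj G)) eq closed)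

      segment-inX : All (_∈ X) (y ∷ z ∷ Z ++ y' ∷ Q)
      segment-inX = AllP.++⁻ʳ L₁ (subst (All (_∈ X)) eq walk-inX)

      y∈X : y ∈ X
      y∈X = All.head segment-inX
      z∈X : z ∈ X
      z∈X = All.head (All.tail segment-inX)

      yz : Adj G y z
      yz = Linked.head segment-linked

      run-linked : Linked (Adj G) (z ∷ Z ++ y' ∷ Q)
      run-linked = Linked.tail segment-linked

      wy' : Adj G (lastOr z Z) y'
      wy' = proj₂ (linked-unsnoc z Z (linked-prefix z Z run-linked))

      w≈z : blockOf (lastOr z Z) ≡ blockOf z
      w≈z = lastOr-all z Z (refl ∷ run)

      -- The ends coincide: if y ∈ S it is alone in its block; otherwise z ∈ S, the run
      -- is z alone, and y, y' are neighbours of z in the component of y.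
      y≡y' : y ≡ y'
      y≡y' with blockOf-cases y
      ... | inj₁ (y∈S , _) = sym (blockOf-S y∈S (sym yy'))
      ... | inj₂ (y∉S , _) with blockOf-edge-S y∈X z∈X yz y≁z
      ...   | inj₁ y∈S = ⊥-elim (y∉S y∈S)
      ...   | inj₂ z∈S = one-neighbour (x∈p∩q⁺ (z∈X , z∈S))
                           (component-isComponent (x∈p∧x∉q⇒x∈p─q y∈X y∉S))
                           (∈-component⁺ ε) (blockOf-component y∉S (sym yy'))
                           (adj-sym yz) (subst (λ Z → Adj G (lastOr z Z) y') (run-at-S z Z z∈S run run-linked) wy')

      -- Hence the segment is the whole closed walk,
      rest≡ : z ∷ Z ≡ rest
      rest≡ = closed-walk-repeat v0 rest L₁ y (z ∷ Z) Q distinct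
                (sym (subst (λ y' → walk ≡ L₁ ++ y ∷ z ∷ Z ++ y' ∷ Q) (sym y≡y') eq))

      -- and the run has at least two vertices, the cycle having length ≥ 3.
      Z≢[] : Z ≢ []
      Z≢[] Z≡[] with subst (λ r → 2 ≤ length r) (trans (sym rest≡) (cong (z ∷_) Z≡[])) long
      ... | s≤s ()

      -- But the run is a single vertex: if z ∈ S it is alone in its block; otherwise
      -- y ∈ S, and z and w are neighbours of y in the component of z, so w = z.
      Z≡[] : Z ≡ []
      Z≡[] with blockOf-cases z
      ... | inj₁ (z∈S , _) = run-at-S z Z z∈S run run-linked
      ... | inj₂ (z∉S , _) with blockOf-edge-S y∈X z∈X yz y≁z
      ...   | inj₂ z∈S = ⊥-elim (z∉S z∈S)
      ...   | inj₁ y∈S = lastOr-self z Z z∉Z (sym (one-neighbour (x∈p∩q⁺ (y∈X , y∈S))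
                           (component-isComponent (x∈p∧x∉q⇒x∈p─q z∈X z∉S))
                           (∈-component⁺ ε) (blockOf-component z∉S w≈z)
                           yz (adj-sym (subst (Adj G (lastOr z Z)) (sym y≡y') wy'))))
        where
        z∉Z : z ∉ₗ Z
        z∉Z with subst Unique (sym rest≡) (AllPairs.tail distinct)
        ... | z∉ ∷ _ = All¬⇒¬Any z∉

    image-noBounce : NoBounce (map blockOf walk)
    image-noBounce P a b Zs Q eq run a≢b with map-split blockOf P walk eq
    ... | L₁ , L₂ , walk≡ , _ , eq₂ with map-cons blockOf L₂ eq₂
    ... | y , L₃ , refl , fy , eq₃ with map-cons blockOf L₃ eq₃
    ... | z , L₄ , refl , fz , eq₄ with map-split blockOf Zs L₄ eq₄
    ... | Z , R , refl , fZ , eqR with map-cons blockOf R eqR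
    ... | y' , Q' , refl , fy' , _ =
          no-bounce-segment L₁ y z Z y' Q' walk≡ (trans fy (sym fy')) runZ (λ e → a≢b (trans (sym fy) (trans e fz)))
      where
      runZ : All (λ w → blockOf w ≡ blockOf z) Z
      runZ = All.map (λ e → trans e (sym fz)) (AllP.map⁻ (subst (All (_≡ b)) (sym fZ) run))

    start : Subset n
    start = blockOf v0

    image≡ : map blockOf walk ≡ start ∷ map blockOf rest ++ start ∷ []
    image≡ = cong (start ∷_) (map-++ blockOf rest (v0 ∷ []))

    compressed : List (Subset n)
    compressed = compressFrom start (map blockOf rest ++ start ∷ [])

    compressed-linked : Linked (BlockAdj G) compressed
    compressed-linked = compressFrom-linked step _ _
                          (subst (Linked StepOrStay) image≡ (image-linked walk closed walk-inX))
      where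
      step : ∀ {A B} → StepOrStay A B → A ≢ B → BlockAdj G A B
      step (inj₁ A≡B) A≢B = ⊥-elim (A≢B A≡B)
      step (inj₂ AB)  _   = AB

    compressed-nonBacktracking : NonBacktracking compressed
    compressed-nonBacktracking = compressFrom-nonBacktracking _ _ (subst NoBounce image≡ image-noBounce)

    compressed-blocks : All IsBlk compressed
    compressed-blocks = compressFrom-all _ _ (subst (All IsBlk) image≡ (AllP.map⁺ (All.map blockOf-isBlock walk-inX)))

    -- Direction ⇐ of the theorem, contrapositively: the compressed walk is closed and
    -- non-constant, hence not a path, so it contains a cycle of blocks.
    project-cycle : CycleWith IsBlk (BlockAdj G) (λ _ → ⊤)
    project-cycle with unique-or-cycle _≟ˢ_ (blockAdj-irrefl {G = G}) compressed
                         compressed-linked compressed-nonBacktracking compressed-blocks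
    ... | inj₂ cycle = cycle
    ... | inj₁ unique with compressFrom-ends start (map blockOf rest) start
    ...   | inj₁ (D , eq)   = ⊥-elim (¬unique-repeat [] start D (subst Unique eq unique))
    ...   | inj₂ (_ , same) = ⊥-elim (not-one-block v0 rest long distinct hits (AllP.map⁻ same))

fact2p6 : {n : ℕ} (G : Graph n) (S X : Subset n) →
    (∀ v C → v ∈ X ∩ S → IsComponent G (X ─ S) C → ∣ N G v ∩ C ∣ ≤ 1) →
    (IsSForest G S X ⇔ ContractedForest G S X)
fact2p6 G S X hyp = mk⇔
  (λ noSCycle blockCycle → noSCycle (Lifting.lift-cycle G S X blockCycle))
  (λ noBlockCycle sCycle → noBlockCycle (Projection.OnCycle.project-cycle G S X hyp sCycle))
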